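{- Let $n_1,n_2,n_3,\dots$ be positive integers with $\lim_{i\to\infty}n_i=\infty$. Then $\bigcap_{i=1}^\infty I\Lambda_{n_i}=0$.
   Context: $I\Lambda_n$ is the ideal of $\mathbb{Z}[x_1,\dots,x_n]$ generated by the polynomials symmetric in $x_1,\dots,x_n$ with zero constant term; all these ideals are regarded as subsets of $\mathbb{Z}[x_1,x_2,\dots]$. -}

module Defs where

open import Data.Nat as ℕ using (ℕ; zero; suc; _<_; _<?_; _≤_)
open import Data.Integer as ℤ using (ℤ; 0ℤ; 1ℤ)
open import Data.Fin using (Fin; toℕ; fromℕ<)
open import Data.Fin.Permutation using (Permutation′; _⟨$⟩ʳ_)
open import Data.List using (List; []; _∷_)
open import Data.Product using (Σ; _×_; _,_)
open import Relation.Nullary using (yes; no)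
open import Relation.Binary.PropositionalEquality using (_≡_)

-- ℤ[x₁,x₂,…] as the free commutative ring on countably many generators:
-- syntactic expressions modulo the congruence generated by the
-- commutative-ring axioms (plus: constants form a copy of ℤ).
-- Variable  var i  stands for x_{i+1}  (0-indexed).

infixl 6 _⊕_
infixl 7 _⊗_
infix 4 _≈_

data Poly : Set where
  con  : ℤ → Poly
  var  : ℕ → Poly
  _⊕_  : Poly → Poly → Poly
  _⊗_  : Poly → Poly → Poly
  ⊝_   : Poly → Poly

data _≈_ : Poly → Poly → Set where
  ≈-refl  : ∀ {p} → p ≈ p
  ≈-sym   : ∀ {p q} → p ≈ q → q ≈ p
  ≈-trans : ∀ {p q r} → p ≈ q → q ≈ r → p ≈ r
  ⊕-cong  : ∀ {p p′ q q′} → p ≈ p′ → q ≈ q′ → p ⊕ q ≈ p′ ⊕ q′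
  ⊗-cong  : ∀ {p p′ q q′} → p ≈ p′ → q ≈ q′ → p ⊗ q ≈ p′ ⊗ q′
  ⊝-cong  : ∀ {p p′} → p ≈ p′ → ⊝ p ≈ ⊝ p′
  ⊕-assoc : ∀ p q r → (p ⊕ q) ⊕ r ≈ p ⊕ (q ⊕ r)
  ⊕-comm  : ∀ p q → p ⊕ q ≈ q ⊕ p
  ⊕-idˡ   : ∀ p → con 0ℤ ⊕ p ≈ p
  ⊕-invʳ  : ∀ p → p ⊕ ⊝ p ≈ con 0ℤ
  ⊗-assoc : ∀ p q r → (p ⊗ q) ⊗ r ≈ p ⊗ (q ⊗ r)
  ⊗-comm  : ∀ p q → p ⊗ q ≈ q ⊗ p
  ⊗-idˡ   : ∀ p → con 1ℤ ⊗ p ≈ p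
  distribˡ : ∀ p q r → p ⊗ (q ⊕ r) ≈ (p ⊗ q) ⊕ (p ⊗ r)
  con-+   : ∀ a b → con a ⊕ con b ≈ con (a ℤ.+ b)
  con-*   : ∀ a b → con a ⊗ con b ≈ con (a ℤ.* b)
  con-neg : ∀ a → ⊝ con a ≈ con (ℤ.- a)

constTerm : Poly → ℤ
constTerm (con a) = a
constTerm (var _) = 0ℤ
constTerm (p ⊕ q) = constTerm p ℤ.+ constTerm q
constTerm (p ⊗ q) = constTerm p ℤ.* constTerm q
constTerm (⊝ p)   = ℤ.- constTerm p

data InVars (n : ℕ) : Poly → Set where
  con : ∀ a → InVars n (con a)
  var : ∀ {i} → i < n → InVars n (var i)
  _⊕_ : ∀ {p q} → InVars n p → InVars n q → InVars n (p ⊕ q)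
  _⊗_ : ∀ {p q} → InVars n p → InVars n q → InVars n (p ⊗ q)
  ⊝_  : ∀ {p} → InVars n p → InVars n (⊝ p)

InRing : ℕ → Poly → Set
InRing n p = Σ Poly λ q → InVars n q × (p ≈ q)

permVar : ∀ {n} → Permutation′ n → ℕ → ℕ
permVar {n} σ i with i <? n
... | yes i<n = toℕ (σ ⟨$⟩ʳ fromℕ< i<n)
... | no _    = i

rename : ∀ {n} → Permutation′ n → Poly → Poly
rename σ (con a) = con a
rename σ (var i) = var (permVar σ i)
rename σ (p ⊕ q) = rename σ p ⊕ rename σ q
rename σ (p ⊗ q) = rename σ p ⊗ rename σ q
rename σ (⊝ p)   = ⊝ rename σ p

SymGen : ℕ → Poly → Set
SymGen n s = InRing n s × (∀ (σ : Permutation′ n) → rename σ s ≈ s) × (constTerm s ≡ 0ℤ)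

sumProd : List (Poly × Poly) → Poly
sumProd []             = con 0ℤ
sumProd ((r , s) ∷ xs) = r ⊗ s ⊕ sumProd xs

data AllGen (n : ℕ) : List (Poly × Poly) → Set where
  []  : AllGen n []
  _∷_ : ∀ {r s xs} → InRing n r × SymGen n s → AllGen n xs → AllGen n ((r , s) ∷ xs)

-- IΛₙ : the ideal of ℤ[x₁,…,xₙ] generated by the symmetric polynomials
-- with zero constant term, regarded as a subset of ℤ[x₁,x₂,…].
IΛ : ℕ → Poly → Set
IΛ n p = Σ (List (Poly × Poly)) λ xs → AllGen n xs × (p ≈ sumProd xs)

-- Let p lie in every IΛ_{nᵢ} and write it as a polynomial q in x₁,…,xₘ (m = n₀).
-- Fix d, put r = d! + 1 and N = 2ʳ − 1: modulo N, 2ʳ = 1 but c = 2ᵉc forces c = 0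
-- for 1 ≤ e ≤ d.  Choose nᵢ ≥ rm and send x_{l+1} ↦ 2^{⌊l/m⌋} y_{l mod m} (l < rm),
-- all other variables ↦ 0, into (ℤ/N)[[y₀,…,y_{m-1}]].  The cyclic permutation
-- l ↦ l + m (mod rm) of the variables acts on these values as the endomorphism θ
-- multiplying the degree-t part by 2ᵗ.  Hence a symmetric polynomial with zero
-- constant term goes to a θ-fixed series without constant term, which vanishes in
-- all degrees ≤ d; so does the image of the ideal IΛ_{nᵢ}, in particular q(y).
-- Letting d grow, every coefficient of q is divisible by arbitrarily large N, so q = 0.
module Submission where

open import Level using (0ℓ)
open import Function using (_∘_)
open import Algebra.Bundles using (CommutativeRing)
open import Algebra.Structures using (IsCommutativeRing)
import Algebra.Construct.Pointwise as Pointwise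
import Algebra.Properties.Ring as RingProperties
import Algebra.Properties.Semiring.Exp as SemiringExp
import Algebra.Properties.CommutativeSemigroup as CommutativeSemigroupProperties
import Relation.Binary.Reasoning.Setoid as SetoidReasoning
open import Data.Nat as ℕ using (ℕ; zero; suc; _≤_; _<_; z≤n; s≤s; _<?_; _%_; _/_; _∸_; _!; NonZero)
import Data.Nat.Properties as ℕP
open import Data.Nat.DivMod
  using (m≡m%n+[m/n]*n; m%n<n; %-distribˡ-+; m%n%n≡m%n; [m+n]%n≡m%n; m<n⇒m%n≡m; m<n⇒m/n≡0; m%[n*o]/o≡m/o%n; m/n≡1+[m∸n]/n; m∣n⇒o%n%m≡o%m)
import Data.Nat.Divisibility as ℕ∣
open import Data.Integer as ℤ using (ℤ; 0ℤ; 1ℤ; +_; ∣_∣)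
import Data.Integer.Properties as ℤP
open import Data.Integer.Divisibility.Signed using (_∣_; divides; ∣m∣n⇒∣m+n; ∣m⇒∣-m; ∣n⇒∣m*n; ∣m⇒∣m*n; ∣⇒∣ᵤ)
open import Data.Integer.Tactic.RingSolver using (solve-∀)
open import Data.Fin using (Fin; toℕ; fromℕ<)
open import Data.Fin.Properties using (toℕ<n; toℕ-fromℕ<; toℕ-injective)
open import Data.Fin.Permutation using (Permutation′; permutation)
open import Data.List using (List; []; _∷_)
open import Data.Product using (Σ; ∃; _×_; _,_; proj₁; proj₂)
open import Relation.Binary.PropositionalEquality as Eq using (_≡_)
open import Relation.Nullary using (Dec; yes; no; ¬_)
open import Data.Empty using (⊥-elim)
open import Defs

record IsRingHom (A B : CommutativeRing 0ℓ 0ℓ)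
                 (f : CommutativeRing.Carrier A → CommutativeRing.Carrier B) : Set where
  private
    module A = CommutativeRing A
    module B = CommutativeRing B
  field
    cong    : ∀ {x y} → x A.≈ y → f x B.≈ f y
    +-homo  : ∀ x y → f (x A.+ y) B.≈ f x B.+ f y
    *-homo  : ∀ x y → f (x A.* y) B.≈ f x B.* f y
    -‿homo  : ∀ x → f (A.- x) B.≈ B.- f x
    0#-homo : f A.0# B.≈ B.0#
    1#-homo : f A.1# B.≈ B.1#

id-hom : ∀ {A} → IsRingHom A A (λ x → x)
id-hom {A} = record
  { cong = λ x≈y → x≈y ; +-homo = λ _ _ → refl ; *-homo = λ _ _ → refl
  ; -‿homo = λ _ → refl ; 0#-homo = refl ; 1#-homo = refl }
  where open CommutativeRing A using (refl)

module _ {A B C : CommutativeRing 0ℓ 0ℓ} where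
  private
    module A = CommutativeRing A
    module B = CommutativeRing B
    module C = CommutativeRing C

  ∘-hom : ∀ {g f} → IsRingHom B C g → IsRingHom A B f → IsRingHom A C (g ∘ f)
  ∘-hom {g} {f} G F = record
    { cong    = G.cong ∘ F.cong
    ; +-homo  = λ x y → C.trans (G.cong (F.+-homo x y)) (G.+-homo (f x) (f y))
    ; *-homo  = λ x y → C.trans (G.cong (F.*-homo x y)) (G.*-homo (f x) (f y))
    ; -‿homo  = λ x → C.trans (G.cong (F.-‿homo x)) (G.-‿homo (f x))
    ; 0#-homo = C.trans (G.cong F.0#-homo) G.0#-homo
    ; 1#-homo = C.trans (G.cong F.1#-homo) G.1#-homo
    }
    where
    module G = IsRingHom G
    module F = IsRingHom F

ℤ-ring : CommutativeRing 0ℓ 0ℓ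
ℤ-ring = ℤP.+-*-commutativeRing

module Evaluation (M : CommutativeRing 0ℓ 0ℓ) where
  open CommutativeRing M renaming (Carrier to A; _≈_ to _≃_; distribˡ to *-distribˡ)

  eval : (ℤ → A) → (ℕ → A) → Poly → A
  eval ι v (con a) = ι a
  eval ι v (var i) = v i
  eval ι v (p ⊕ q) = eval ι v p + eval ι v q
  eval ι v (p ⊗ q) = eval ι v p * eval ι v q
  eval ι v (⊝ p)   = - eval ι v p

  eval-cong : ∀ {ι} → IsRingHom ℤ-ring M ι → ∀ v {p q} → p ≈ q → eval ι v p ≃ eval ι v q
  eval-cong H v ≈-refl             = refl
  eval-cong H v (≈-sym e)          = sym (eval-cong H v e)
  eval-cong H v (≈-trans e f)      = trans (eval-cong H v e) (eval-cong H v f)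
  eval-cong H v (⊕-cong e f)       = +-cong (eval-cong H v e) (eval-cong H v f)
  eval-cong H v (⊗-cong e f)       = *-cong (eval-cong H v e) (eval-cong H v f)
  eval-cong H v (⊝-cong e)         = -‿cong (eval-cong H v e)
  eval-cong H v (⊕-assoc p q r)    = +-assoc _ _ _
  eval-cong H v (⊕-comm p q)       = +-comm _ _
  eval-cong H v (⊕-idˡ p)          = trans (+-cong (IsRingHom.0#-homo H) refl) (+-identityˡ _)
  eval-cong H v (⊕-invʳ p)         = trans (-‿inverseʳ _) (sym (IsRingHom.0#-homo H))
  eval-cong H v (⊗-assoc p q r)    = *-assoc _ _ _
  eval-cong H v (⊗-comm p q)       = *-comm _ _
  eval-cong H v (⊗-idˡ p)          = trans (*-cong (IsRingHom.1#-homo H) refl) (*-identityˡ _)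
  eval-cong H v (distribˡ p q r)    = *-distribˡ _ _ _
  eval-cong H v (con-+ a b)        = sym (IsRingHom.+-homo H a b)
  eval-cong H v (con-* a b)        = sym (IsRingHom.*-homo H a b)
  eval-cong H v (con-neg a)        = sym (IsRingHom.-‿homo H a)

  eval-ext : ∀ {ι ι′ v w} → (∀ a → ι a ≃ ι′ a) → (∀ i → v i ≃ w i) → ∀ p → eval ι v p ≃ eval ι′ w p
  eval-ext hι hv (con a) = hι a
  eval-ext hι hv (var i) = hv i
  eval-ext hι hv (p ⊕ q) = +-cong (eval-ext hι hv p) (eval-ext hι hv q)
  eval-ext hι hv (p ⊗ q) = *-cong (eval-ext hι hv p) (eval-ext hι hv q)
  eval-ext hι hv (⊝ p)   = -‿cong (eval-ext hι hv p)

  eval-local : ∀ ι {m v w q} → InVars m q → (∀ i → i < m → v i ≃ w i) → eval ι v q ≃ eval ι w q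
  eval-local ι (con a) h = refl
  eval-local ι (var i<m) h = h _ i<m
  eval-local ι (a ⊕ b) h = +-cong (eval-local ι a h) (eval-local ι b h)
  eval-local ι (a ⊗ b) h = *-cong (eval-local ι a h) (eval-local ι b h)
  eval-local ι (⊝ a) h   = -‿cong (eval-local ι a h)

  eval-rename : ∀ ι v {n} (σ : _) p → eval ι v (rename {n} σ p) ≡ eval ι (v ∘ permVar σ) p
  eval-rename ι v σ (con a) = Eq.refl
  eval-rename ι v σ (var i) = Eq.refl
  eval-rename ι v σ (p ⊕ q) = Eq.cong₂ _+_ (eval-rename ι v σ p) (eval-rename ι v σ q)
  eval-rename ι v σ (p ⊗ q) = Eq.cong₂ _*_ (eval-rename ι v σ p) (eval-rename ι v σ q)
  eval-rename ι v σ (⊝ p)   = Eq.cong -_ (eval-rename ι v σ p)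

  eval-at-zero : ∀ {ι} → IsRingHom ℤ-ring M ι → ∀ p → eval ι (λ _ → 0#) p ≃ ι (constTerm p)
  eval-at-zero H (con a) = refl
  eval-at-zero H (var i) = sym (IsRingHom.0#-homo H)
  eval-at-zero H (p ⊕ q) = trans (+-cong (eval-at-zero H p) (eval-at-zero H q)) (sym (IsRingHom.+-homo H _ _))
  eval-at-zero H (p ⊗ q) = trans (*-cong (eval-at-zero H p) (eval-at-zero H q)) (sym (IsRingHom.*-homo H _ _))
  eval-at-zero H (⊝ p)   = trans (-‿cong (eval-at-zero H p)) (sym (IsRingHom.-‿homo H _))

open Evaluation using (eval; eval-cong; eval-ext; eval-local; eval-rename; eval-at-zero)

module _ {A B : CommutativeRing 0ℓ 0ℓ} {f} (F : IsRingHom A B f) where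
  private
    module A = CommutativeRing A
    module B = CommutativeRing B
    module A^ = SemiringExp A.semiring
    module B^ = SemiringExp B.semiring
    module F = IsRingHom F

  ^-homo : ∀ x n → f (x A^.^ n) B.≈ f x B^.^ n
  ^-homo x zero    = F.1#-homo
  ^-homo x (suc n) = B.trans (F.*-homo x (x A^.^ n)) (B.*-cong B.refl (^-homo x n))

  eval-hom : ∀ ι v p → f (eval A ι v p) B.≈ eval B (f ∘ ι) (f ∘ v) p
  eval-hom ι v (con a) = B.refl
  eval-hom ι v (var i) = B.refl
  eval-hom ι v (p ⊕ q) = B.trans (F.+-homo _ _) (B.+-cong (eval-hom ι v p) (eval-hom ι v q))
  eval-hom ι v (p ⊗ q) = B.trans (F.*-homo _ _) (B.*-cong (eval-hom ι v p) (eval-hom ι v q))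
  eval-hom ι v (⊝ p)   = B.trans (F.-‿homo _) (B.-‿cong (eval-hom ι v p))

module _ (R : CommutativeRing 0ℓ 0ℓ) where
  private
    module R = CommutativeRing R
    module R^ = SemiringExp R.semiring

  ^-mod : ∀ x r .{{_ : NonZero r}} → x R^.^ r R.≈ R.1# → ∀ k → x R^.^ (k % r) R.≈ x R^.^ k
  ^-mod x r xʳ≈1 k = sym (begin
      x ^ k                                 ≈⟨ ^-congʳ x (m≡m%n+[m/n]*n k r) ⟩
      x ^ (k % r ℕ.+ (k / r) ℕ.* r)         ≈⟨ ^-homo-* x (k % r) _ ⟩
      x ^ (k % r) * x ^ ((k / r) ℕ.* r)     ≈⟨ *-cong refl (power-of-period (k / r)) ⟩
      x ^ (k % r) * 1#                      ≈⟨ *-identityʳ _ ⟩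
      x ^ (k % r)                           ∎)
    where
    open CommutativeRing R renaming (_≈_ to _≃_)
    open SemiringExp semiring using (_^_; ^-homo-*; ^-congʳ)
    open SetoidReasoning setoid
    power-of-period : ∀ q → x ^ (q ℕ.* r) ≃ 1#
    power-of-period zero    = refl
    power-of-period (suc q) = trans (^-homo-* x r (q ℕ.* r))
                                    (trans (*-cong xʳ≈1 (power-of-period q)) (*-identityˡ 1#))

module PowerSeries (R : CommutativeRing 0ℓ 0ℓ) where
  open CommutativeRing R hiding (zero)
    renaming (Carrier to A; _≈_ to _≃_; distribˡ to *-distribˡ; distribʳ to *-distribʳ)
  open SetoidReasoning setoid
  open CommutativeSemigroupProperties +-commutativeSemigroup using (interchange; x∙yz≈y∙xz)
  module *-Comm = CommutativeSemigroupProperties *-commutativeSemigroup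
  open RingProperties (CommutativeRing.ring R) using (-0#≈0#; -‿distribʳ-*)
  open SemiringExp semiring using (_^_)

  Series : Set
  Series = ℕ → A

  infix 4 _≋_
  _≋_ : Series → Series → Set
  f ≋ g = ∀ k → f k ≃ g k

  infixl 6 _+ₛ_
  _+ₛ_ : Series → Series → Series
  (f +ₛ g) k = f k + g k

  0ₛ : Series
  0ₛ _ = 0#

  const : A → Series
  const c zero    = c
  const c (suc k) = 0#

  1ₛ : Series
  1ₛ = const 1#

  shift : Series → Series
  shift f zero    = 0#
  shift f (suc k) = f k

  tail : Series → Series
  tail f k = f (suc k)

  scale : A → Series → Series
  scale c f k = c * f k

  infixl 7 _*ₛ_
  _*ₛ_ : Series → Series → Series
  (f *ₛ g) zero    = f 0 * g 0
  (f *ₛ g) (suc n) = f 0 * g (suc n) + (tail f *ₛ g) n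

  *ₛ-cong : ∀ {f f′ g g′} → f ≋ f′ → g ≋ g′ → f *ₛ g ≋ f′ *ₛ g′
  *ₛ-cong f≋ g≋ zero    = *-cong (f≋ 0) (g≋ 0)
  *ₛ-cong f≋ g≋ (suc n) = +-cong (*-cong (f≋ 0) (g≋ (suc n))) (*ₛ-cong (f≋ ∘ suc) g≋ n)

  *ₛ-distribʳ : ∀ g f h → (f +ₛ h) *ₛ g ≋ f *ₛ g +ₛ h *ₛ g
  *ₛ-distribʳ g f h zero    = *-distribʳ (g 0) (f 0) (h 0)
  *ₛ-distribʳ g f h (suc n) = begin
      (f 0 + h 0) * g (suc n) + ((tail f +ₛ tail h) *ₛ g) n
    ≈⟨ +-cong (*-distribʳ (g (suc n)) (f 0) (h 0)) (*ₛ-distribʳ g (tail f) (tail h) n) ⟩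
      (f 0 * g (suc n) + h 0 * g (suc n)) + ((tail f *ₛ g) n + (tail h *ₛ g) n)
    ≈⟨ interchange _ _ _ _ ⟩
      (f 0 * g (suc n) + (tail f *ₛ g) n) + (h 0 * g (suc n) + (tail h *ₛ g) n) ∎

  *ₛ-zeroˡ : ∀ g → 0ₛ *ₛ g ≋ 0ₛ
  *ₛ-zeroˡ g zero    = zeroˡ (g 0)
  *ₛ-zeroˡ g (suc n) = trans (+-cong (zeroˡ _) (*ₛ-zeroˡ g n)) (+-identityˡ 0#)

  const-*ₛ : ∀ c g → const c *ₛ g ≋ scale c g
  const-*ₛ c g zero    = refl
  const-*ₛ c g (suc n) = trans (+-cong refl (*ₛ-zeroˡ g n)) (+-identityʳ _)

  shift-*ₛ : ∀ f g → shift f *ₛ g ≋ shift (f *ₛ g)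
  shift-*ₛ f g zero    = zeroˡ (g 0)
  shift-*ₛ f g (suc n) = trans (+-cong (zeroˡ _) refl) (+-identityˡ _)

  scale-*ₛ : ∀ c f g → scale c f *ₛ g ≋ scale c (f *ₛ g)
  scale-*ₛ c f g zero    = *-assoc c (f 0) (g 0)
  scale-*ₛ c f g (suc n) = begin
      c * f 0 * g (suc n) + (scale c (tail f) *ₛ g) n
    ≈⟨ +-cong (*-assoc c (f 0) (g (suc n))) (scale-*ₛ c (tail f) g n) ⟩
      c * (f 0 * g (suc n)) + c * (tail f *ₛ g) n
    ≈⟨ sym (*-distribˡ c _ _) ⟩
      c * (f 0 * g (suc n) + (tail f *ₛ g) n) ∎

  -- Commutativity needs a two-step unfolding: both sides of degree n+2 share
  -- the term (tail f *ₛ tail g) n after peeling off f₀ and g₀.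
  *ₛ-comm : ∀ f g → f *ₛ g ≋ g *ₛ f
  *ₛ-comm f g zero = *-comm (f 0) (g 0)
  *ₛ-comm f g (suc zero) = begin
      f 0 * g 1 + f 1 * g 0   ≈⟨ +-cong (*-comm _ _) (*-comm _ _) ⟩
      g 1 * f 0 + g 0 * f 1   ≈⟨ +-comm _ _ ⟩
      g 0 * f 1 + g 1 * f 0   ∎
  *ₛ-comm f g (suc (suc n)) = begin
      f 0 * g (suc (suc n)) + (tail f *ₛ g) (suc n)
    ≈⟨ +-cong refl (*ₛ-comm (tail f) g (suc n)) ⟩
      f 0 * g (suc (suc n)) + (g 0 * f (suc (suc n)) + (tail g *ₛ tail f) n)
    ≈⟨ x∙yz≈y∙xz _ _ _ ⟩
      g 0 * f (suc (suc n)) + (f 0 * g (suc (suc n)) + (tail g *ₛ tail f) n)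
    ≈⟨ +-cong refl (+-cong refl (*ₛ-comm (tail g) (tail f) n)) ⟩
      g 0 * f (suc (suc n)) + (f 0 * g (suc (suc n)) + (tail f *ₛ tail g) n)
    ≈⟨ +-cong refl (*ₛ-comm f (tail g) (suc n)) ⟩
      g 0 * f (suc (suc n)) + (tail g *ₛ f) (suc n) ∎

  *ₛ-assoc : ∀ f g h → (f *ₛ g) *ₛ h ≋ f *ₛ (g *ₛ h)
  *ₛ-assoc f g h zero    = *-assoc (f 0) (g 0) (h 0)
  *ₛ-assoc f g h (suc n) = begin
      f 0 * g 0 * h (suc n) + ((scale (f 0) (tail g) +ₛ tail f *ₛ g) *ₛ h) n
    ≈⟨ +-cong (*-assoc _ _ _) (*ₛ-distribʳ h (scale (f 0) (tail g)) (tail f *ₛ g) n) ⟩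
      f 0 * (g 0 * h (suc n)) + ((scale (f 0) (tail g) *ₛ h) n + ((tail f *ₛ g) *ₛ h) n)
    ≈⟨ +-cong refl (+-cong (scale-*ₛ (f 0) (tail g) h n) (*ₛ-assoc (tail f) g h n)) ⟩
      f 0 * (g 0 * h (suc n)) + (f 0 * (tail g *ₛ h) n + (tail f *ₛ (g *ₛ h)) n)
    ≈⟨ sym (+-assoc _ _ _) ⟩
      (f 0 * (g 0 * h (suc n)) + f 0 * (tail g *ₛ h) n) + (tail f *ₛ (g *ₛ h)) n
    ≈⟨ +-cong (sym (*-distribˡ _ _ _)) refl ⟩
      f 0 * (g *ₛ h) (suc n) + (tail f *ₛ (g *ₛ h)) n ∎

  *ₛ-identityˡ : ∀ g → 1ₛ *ₛ g ≋ g
  *ₛ-identityˡ g n = trans (const-*ₛ 1# g n) (*-identityˡ (g n))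

  *ₛ-identityʳ : ∀ g → g *ₛ 1ₛ ≋ g
  *ₛ-identityʳ g n = trans (*ₛ-comm g 1ₛ n) (*ₛ-identityˡ g n)

  *ₛ-distribˡ : ∀ f g h → f *ₛ (g +ₛ h) ≋ f *ₛ g +ₛ f *ₛ h
  *ₛ-distribˡ f g h n = trans (*ₛ-comm f (g +ₛ h) n)
    (trans (*ₛ-distribʳ f g h n) (+-cong (*ₛ-comm g f n) (*ₛ-comm h f n)))

  seriesRing : CommutativeRing 0ℓ 0ℓ
  seriesRing = record { isCommutativeRing = record
    { isRing = record
      { +-isAbelianGroup = Pointwise.isAbelianGroup ℕ +-isAbelianGroup
      ; *-cong = *ₛ-cong
      ; *-assoc = *ₛ-assoc
      ; *-identity = *ₛ-identityˡ , *ₛ-identityʳ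
      ; distrib = *ₛ-distribˡ , *ₛ-distribʳ
      }
    ; *-comm = *ₛ-comm
    } }

  y : Series
  y = shift 1ₛ

  y-*ₛ : ∀ h → y *ₛ h ≋ shift h
  y-*ₛ h zero    = shift-*ₛ 1ₛ h zero
  y-*ₛ h (suc n) = trans (shift-*ₛ 1ₛ h (suc n)) (*ₛ-identityˡ h n)

  const-hom : IsRingHom R seriesRing const
  const-hom = record
    { cong    = λ { c≃d zero → c≃d ; c≃d (suc k) → refl }
    ; +-homo  = λ { c d zero → refl ; c d (suc k) → sym (+-identityˡ 0#) }
    ; *-homo  = λ c d k → sym (trans (const-*ₛ c (const d) k) (scale-const c d k))
    ; -‿homo  = λ { c zero → refl ; c (suc k) → sym -0#≈0# }
    ; 0#-homo = λ { zero → refl ; (suc k) → refl }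
    ; 1#-homo = λ _ → refl
    }
    where
    scale-const : ∀ c d → scale c (const d) ≋ const (c * d)
    scale-const c d zero    = refl
    scale-const c d (suc k) = zeroʳ c

  coeff₀-hom : IsRingHom seriesRing R (λ f → f 0)
  coeff₀-hom = record
    { cong = λ f≋g → f≋g 0 ; +-homo = λ _ _ → refl ; *-homo = λ _ _ → refl
    ; -‿homo = λ _ → refl ; 0#-homo = refl ; 1#-homo = refl }

  module Weighted (φ : A → A) (a : A) where
    weighted : Series → Series
    weighted f k = a ^ k * φ (f k)

    private
      1*φ≃φ : ∀ x → a ^ 0 * φ x ≃ φ x
      1*φ≃φ x = *-identityˡ (φ x)

      tail-weighted : ∀ f → tail (weighted f) ≋ scale a (weighted (tail f))
      tail-weighted f k = *-assoc a (a ^ k) (φ (f (suc k)))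

    module _ (Φ : IsRingHom R R φ) where
      private module Φ = IsRingHom Φ

      weighted-*ₛ : ∀ f g → weighted (f *ₛ g) ≋ weighted f *ₛ weighted g
      weighted-*ₛ f g zero = begin
          a ^ 0 * φ (f 0 * g 0)            ≈⟨ 1*φ≃φ _ ⟩
          φ (f 0 * g 0)                    ≈⟨ Φ.*-homo _ _ ⟩
          φ (f 0) * φ (g 0)                ≈⟨ sym (*-cong (1*φ≃φ _) (1*φ≃φ _)) ⟩
          a ^ 0 * φ (f 0) * (a ^ 0 * φ (g 0)) ∎
      weighted-*ₛ f g (suc n) = begin
          a ^ suc n * φ (f 0 * g (suc n) + (tail f *ₛ g) n)
        ≈⟨ trans (*-cong refl (Φ.+-homo _ _)) (*-distribˡ _ _ _) ⟩
          a ^ suc n * φ (f 0 * g (suc n)) + a ^ suc n * φ ((tail f *ₛ g) n)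
        ≈⟨ +-cong leading rest ⟩
          a ^ 0 * φ (f 0) * weighted g (suc n) + (tail (weighted f) *ₛ weighted g) n ∎
        where
        leading : a ^ suc n * φ (f 0 * g (suc n)) ≃ a ^ 0 * φ (f 0) * weighted g (suc n)
        leading = begin
            a ^ suc n * φ (f 0 * g (suc n))        ≈⟨ *-cong refl (Φ.*-homo _ _) ⟩
            a ^ suc n * (φ (f 0) * φ (g (suc n)))  ≈⟨ *-Comm.x∙yz≈y∙xz _ _ _ ⟩
            φ (f 0) * weighted g (suc n)           ≈⟨ *-cong (sym (1*φ≃φ _)) refl ⟩
            a ^ 0 * φ (f 0) * weighted g (suc n)   ∎
        rest : a ^ suc n * φ ((tail f *ₛ g) n) ≃ (tail (weighted f) *ₛ weighted g) n
        rest = begin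
            a * a ^ n * φ ((tail f *ₛ g) n)               ≈⟨ *-assoc _ _ _ ⟩
            a * weighted (tail f *ₛ g) n                  ≈⟨ *-cong refl (weighted-*ₛ (tail f) g n) ⟩
            a * (weighted (tail f) *ₛ weighted g) n       ≈⟨ sym (scale-*ₛ a _ _ n) ⟩
            (scale a (weighted (tail f)) *ₛ weighted g) n ≈⟨ sym (*ₛ-cong (tail-weighted f) (λ _ → refl) n) ⟩
            (tail (weighted f) *ₛ weighted g) n            ∎

      weighted-hom : IsRingHom seriesRing seriesRing weighted
      weighted-hom = record
        { cong    = λ f≋g k → *-cong refl (Φ.cong (f≋g k))
        ; +-homo  = λ f g k → trans (*-cong refl (Φ.+-homo _ _)) (*-distribˡ _ _ _)
        ; *-homo  = weighted-*ₛ
        ; -‿homo  = λ f k → trans (*-cong refl (Φ.-‿homo _)) (sym (-‿distribʳ-* _ _))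
        ; 0#-homo = λ k → trans (*-cong refl Φ.0#-homo) (zeroʳ _)
        ; 1#-homo = λ { zero → trans (1*φ≃φ _) Φ.1#-homo
                      ; (suc k) → trans (*-cong refl Φ.0#-homo) (zeroʳ _) }
        }

      weighted-const : ∀ c → weighted (const c) ≋ const (φ c)
      weighted-const c zero    = 1*φ≃φ c
      weighted-const c (suc k) = trans (*-cong refl Φ.0#-homo) (zeroʳ _)

      weighted-y : weighted y ≋ const a *ₛ y
      weighted-y k = trans (coefficient k) (sym (const-*ₛ a y k))
        where
        coefficient : ∀ k → weighted y k ≃ a * y k
        coefficient zero          = trans (*-cong refl Φ.0#-homo) (trans (zeroʳ _) (sym (zeroʳ a)))
        coefficient (suc zero)    = *-cong (*-identityʳ a) Φ.1#-homo
        coefficient (suc (suc k)) = trans (*-cong refl Φ.0#-homo) (trans (zeroʳ _) (sym (zeroʳ a)))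

module ZMod (N : ℤ) where
  infix 4 _≡ₙ_
  record _≡ₙ_ (x y : ℤ) : Set where
    constructor mod
    field divisible : N ∣ x ℤ.- y
  open _≡ₙ_ public

  ≡⇒≡ₙ : ∀ {x y} → x ≡ y → x ≡ₙ y
  ≡⇒≡ₙ {x} Eq.refl = mod (divides 0ℤ (ℤP.+-inverseʳ x))

  private
    via : ∀ {x y z} → z ≡ x ℤ.- y → N ∣ z → x ≡ₙ y
    via z≡x-y N∣z = mod (Eq.subst (N ∣_) z≡x-y N∣z)

    ≡ₙ-sym : ∀ {x y} → x ≡ₙ y → y ≡ₙ x
    ≡ₙ-sym {x} {y} (mod N∣x-y) = via (identity x y) (∣m⇒∣-m N∣x-y)
      where
      identity : ∀ x y → ℤ.- (x ℤ.- y) ≡ y ℤ.- x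
      identity = solve-∀

    ≡ₙ-trans : ∀ {x y z} → x ≡ₙ y → y ≡ₙ z → x ≡ₙ z
    ≡ₙ-trans {x} {y} {z} (mod N∣x-y) (mod N∣y-z) = via (ℤP.+-minus-telescope x y z) (∣m∣n⇒∣m+n N∣x-y N∣y-z)

    +-cong : ∀ {x y u v} → x ≡ₙ y → u ≡ₙ v → x ℤ.+ u ≡ₙ y ℤ.+ v
    +-cong {x} {y} {u} {v} (mod N∣x-y) (mod N∣u-v) = via (identity x y u v) (∣m∣n⇒∣m+n N∣x-y N∣u-v)
      where
      identity : ∀ x y u v → (x ℤ.- y) ℤ.+ (u ℤ.- v) ≡ (x ℤ.+ u) ℤ.- (y ℤ.+ v)
      identity = solve-∀

    *-cong : ∀ {x y u v} → x ≡ₙ y → u ≡ₙ v → x ℤ.* u ≡ₙ y ℤ.* v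
    *-cong {x} {y} {u} {v} (mod N∣x-y) (mod N∣u-v) =
      via (identity x y u v) (∣m∣n⇒∣m+n (∣n⇒∣m*n x N∣u-v) (∣m⇒∣m*n v N∣x-y))
      where
      identity : ∀ x y u v → x ℤ.* (u ℤ.- v) ℤ.+ (x ℤ.- y) ℤ.* v ≡ x ℤ.* u ℤ.- y ℤ.* v
      identity = solve-∀

    -‿cong : ∀ {x y} → x ≡ₙ y → ℤ.- x ≡ₙ ℤ.- y
    -‿cong {x} {y} (mod N∣x-y) = via (identity x y) (∣m⇒∣-m N∣x-y)
      where
      identity : ∀ x y → ℤ.- (x ℤ.- y) ≡ ℤ.- x ℤ.- ℤ.- y
      identity = solve-∀

  ring : CommutativeRing 0ℓ 0ℓ
  ring = record { isCommutativeRing = isCommutativeRing }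
    where
    isCommutativeRing : IsCommutativeRing _≡ₙ_ ℤ._+_ ℤ._*_ ℤ.-_ 0ℤ 1ℤ
    isCommutativeRing = record
      { isRing = record
        { +-isAbelianGroup = record
          { isGroup = record
            { isMonoid = record
              { isSemigroup = record
                { isMagma = record
                  { isEquivalence = record { refl = ≡⇒≡ₙ Eq.refl ; sym = ≡ₙ-sym ; trans = ≡ₙ-trans }
                  ; ∙-cong = +-cong }
                ; assoc = λ x y z → ≡⇒≡ₙ (ℤP.+-assoc x y z) }
              ; identity = (λ x → ≡⇒≡ₙ (ℤP.+-identityˡ x)) , (λ x → ≡⇒≡ₙ (ℤP.+-identityʳ x)) }
            ; inverse = (λ x → ≡⇒≡ₙ (ℤP.+-inverseˡ x)) , (λ x → ≡⇒≡ₙ (ℤP.+-inverseʳ x))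
            ; ⁻¹-cong = -‿cong }
          ; comm = λ x y → ≡⇒≡ₙ (ℤP.+-comm x y) }
        ; *-cong = *-cong
        ; *-assoc = λ x y z → ≡⇒≡ₙ (ℤP.*-assoc x y z)
        ; *-identity = (λ x → ≡⇒≡ₙ (ℤP.*-identityˡ x)) , (λ x → ≡⇒≡ₙ (ℤP.*-identityʳ x))
        ; distrib = (λ x y z → ≡⇒≡ₙ (ℤP.*-distribˡ-+ x y z)) , (λ x y z → ≡⇒≡ₙ (ℤP.*-distribʳ-+ x y z))
        }
      ; *-comm = λ x y → ≡⇒≡ₙ (ℤP.*-comm x y)
      }

  reduce-hom : IsRingHom ℤ-ring ring (λ x → x)
  reduce-hom = record
    { cong = ≡⇒≡ₙ ; +-homo = λ _ _ → ≡⇒≡ₙ Eq.refl ; *-homo = λ _ _ → ≡⇒≡ₙ Eq.refl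
    ; -‿homo = λ _ → ≡⇒≡ₙ Eq.refl ; 0#-homo = ≡⇒≡ₙ Eq.refl ; 1#-homo = ≡⇒≡ₙ Eq.refl }

polyRing : CommutativeRing 0ℓ 0ℓ
polyRing = record { isCommutativeRing = isCommutativeRing }
  where
  ⊕-idʳ : ∀ p → p ⊕ con 0ℤ ≈ p
  ⊕-idʳ p = ≈-trans (⊕-comm p (con 0ℤ)) (⊕-idˡ p)
  ⊗-idʳ : ∀ p → p ⊗ con 1ℤ ≈ p
  ⊗-idʳ p = ≈-trans (⊗-comm p (con 1ℤ)) (⊗-idˡ p)
  ⊕-invˡ : ∀ p → ⊝ p ⊕ p ≈ con 0ℤ
  ⊕-invˡ p = ≈-trans (⊕-comm (⊝ p) p) (⊕-invʳ p)
  distribʳ : ∀ p q r → (q ⊕ r) ⊗ p ≈ q ⊗ p ⊕ r ⊗ p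
  distribʳ p q r = ≈-trans (⊗-comm (q ⊕ r) p) (≈-trans (distribˡ p q r) (⊕-cong (⊗-comm p q) (⊗-comm p r)))
  isCommutativeRing : IsCommutativeRing _≈_ _⊕_ _⊗_ ⊝_ (con 0ℤ) (con 1ℤ)
  isCommutativeRing = record
    { isRing = record
      { +-isAbelianGroup = record
        { isGroup = record
          { isMonoid = record
            { isSemigroup = record
              { isMagma = record
                { isEquivalence = record { refl = ≈-refl ; sym = ≈-sym ; trans = ≈-trans }
                ; ∙-cong = ⊕-cong }
              ; assoc = ⊕-assoc }
            ; identity = ⊕-idˡ , ⊕-idʳ }
          ; inverse = ⊕-invˡ , ⊕-invʳ
          ; ⁻¹-cong = ⊝-cong }
        ; comm = ⊕-comm }
      ; *-cong = ⊗-cong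
      ; *-assoc = ⊗-assoc
      ; *-identity = ⊗-idˡ , ⊗-idʳ
      ; distrib = distribˡ , distribʳ
      }
    ; *-comm = ⊗-comm
    }

IΛ⊆ℤ[x] : ∀ {n p} → IΛ n p → InRing n p
IΛ⊆ℤ[x] {n} (xs , gens , p≈Σ) with sum-in-ring gens
  where
  sum-in-ring : ∀ {xs} → AllGen n xs → InRing n (sumProd xs)
  sum-in-ring [] = con 0ℤ , con 0ℤ , ≈-refl
  sum-in-ring (((_ , rv , r≈) , (_ , sv , s≈) , _) ∷ gens) with sum-in-ring gens
  ... | _ , qv , Σ≈ = _ , (rv ⊗ sv) ⊕ qv , ⊕-cong (⊗-cong r≈ s≈) Σ≈
... | q , qv , Σ≈q = q , qv , ≈-trans p≈Σ Σ≈q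

constant-poly : ∀ {q} → InVars 0 q → q ≈ con (constTerm q)
constant-poly (con a) = ≈-refl
constant-poly (var ())
constant-poly (a ⊕ b) = ≈-trans (⊕-cong (constant-poly a) (constant-poly b)) (con-+ _ _)
constant-poly (a ⊗ b) = ≈-trans (⊗-cong (constant-poly a) (constant-poly b)) (con-* _ _)
constant-poly (⊝ a)   = ≈-trans (⊝-cong (constant-poly a)) (con-neg _)

-- The ring B[[y₀,…,y_{m-1}]] of power series in m variables over B, as the
-- m-fold iterate of B ↦ B[[y]] (the last variable y_{m-1} is outermost).
module Tower (B : CommutativeRing 0ℓ 0ℓ) where
  private module B = CommutativeRing B
  open SemiringExp B.semiring using (_^_)

  Series : ℕ → CommutativeRing 0ℓ 0ℓ
  Series zero    = B
  Series (suc m) = PowerSeries.seriesRing (Series m)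

  S : ℕ → Set
  S m = CommutativeRing.Carrier (Series m)

  module S (m : ℕ) = CommutativeRing (Series m) renaming (_≈_ to _≃_)
  module PS (m : ℕ) = PowerSeries (Series m)

  embed : ∀ m → B.Carrier → S m
  embed zero    c = c
  embed (suc m) c = PS.const m (embed m c)

  embed-hom : ∀ m → IsRingHom B (Series m) (embed m)
  embed-hom zero    = id-hom
  embed-hom (suc m) = ∘-hom (PS.const-hom m) (embed-hom m)

  coeff₀ : ∀ m → S m → B.Carrier
  coeff₀ zero    c = c
  coeff₀ (suc m) f = coeff₀ m (f 0)

  coeff₀-hom : ∀ m → IsRingHom (Series m) B (coeff₀ m)
  coeff₀-hom zero    = id-hom
  coeff₀-hom (suc m) = ∘-hom (coeff₀-hom m) (PS.coeff₀-hom m)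

  coeff₀-embed : ∀ m c → coeff₀ m (embed m c) ≡ c
  coeff₀-embed zero    c = Eq.refl
  coeff₀-embed (suc m) c = coeff₀-embed m c

  -- The variables: y m i is y_i for i < m and 0 for i ≥ m.
  y : ∀ m → ℕ → S m
  y zero    i = B.0#
  y (suc m) i with i ℕ.≟ m
  ... | yes _ = PS.y m
  ... | no  _ = PS.const m (y m i)

  y-top : ∀ m → y (suc m) m ≡ PS.y m
  y-top m with m ℕ.≟ m
  ... | yes _  = Eq.refl
  ... | no m≢m = ⊥-elim (m≢m Eq.refl)

  y-below : ∀ m {i} → i < m → y (suc m) i ≡ PS.const m (y m i)
  y-below m {i} i<m with i ℕ.≟ m
  ... | yes Eq.refl = ⊥-elim (ℕP.<-irrefl Eq.refl i<m)
  ... | no  _       = Eq.refl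

  coeff₀-y : ∀ m i → coeff₀ m (y m i) B.≈ B.0#
  coeff₀-y zero    i = B.refl
  coeff₀-y (suc m) i with i ℕ.≟ m
  ... | yes _ = IsRingHom.0#-homo (coeff₀-hom m)
  ... | no  _ = coeff₀-y m i

  -- Vanish m d e f: the coefficient of f at every monomial of total degree t
  -- with e + t ≤ d is zero, i.e. f vanishes to order d ∸ e at the origin.
  Vanish : ∀ m → ℕ → ℕ → S m → Set
  Vanish zero    d e c = e ≤ d → c B.≈ B.0#
  Vanish (suc m) d e f = ∀ k → Vanish m d (e ℕ.+ k) (f k)

  Vanish-cong : ∀ m {d e f g} → S._≃_ m f g → Vanish m d e f → Vanish m d e g
  Vanish-cong zero    f≈g f-vanishes e≤d = B.trans (B.sym f≈g) (f-vanishes e≤d)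
  Vanish-cong (suc m) f≈g f-vanishes k   = Vanish-cong m (f≈g k) (f-vanishes k)

  Vanish-mono : ∀ m {d e e′ f} → e ≤ e′ → Vanish m d e f → Vanish m d e′ f
  Vanish-mono zero    e≤e′ f-vanishes e′≤d = f-vanishes (ℕP.≤-trans e≤e′ e′≤d)
  Vanish-mono (suc m) e≤e′ f-vanishes k    = Vanish-mono m (ℕP.+-monoˡ-≤ k e≤e′) (f-vanishes k)

  Vanish-0 : ∀ m {d e} → Vanish m d e (S.0# m)
  Vanish-0 zero    _ = B.refl
  Vanish-0 (suc m) k = Vanish-0 m

  Vanish-+ : ∀ m {d e f g} → Vanish m d e f → Vanish m d e g → Vanish m d e (S._+_ m f g)
  Vanish-+ zero    f-vanishes g-vanishes e≤d = B.trans (B.+-cong (f-vanishes e≤d) (g-vanishes e≤d)) (B.+-identityˡ _)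
  Vanish-+ (suc m) f-vanishes g-vanishes k   = Vanish-+ m (f-vanishes k) (g-vanishes k)

  Vanish-* : ∀ m {d e} g {f} → Vanish m d e f → Vanish m d e (S._*_ m g f)
  Vanish-* zero    g f-vanishes e≤d = B.trans (B.*-cong B.refl (f-vanishes e≤d)) (B.zeroʳ g)
  Vanish-* (suc m) {d} {e} g {f} f-vanishes = product g
    where
    product : ∀ g n → Vanish m d (e ℕ.+ n) (PS._*ₛ_ m g f n)
    product g zero    = Vanish-* m (g 0) (f-vanishes 0)
    product g (suc n) = Vanish-+ m (Vanish-* m (g 0) (f-vanishes (suc n)))
                          (Vanish-mono m (ℕP.+-monoʳ-≤ e (ℕP.n≤1+n n)) (product (PS.tail m g) n))

  module Weight (a : B.Carrier) where

    -- θ m multiplies the coefficient of each monomial of total degree t by aᵗ.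
    θ : ∀ m → S m → S m
    θ zero    c = c
    θ (suc m)   = PS.Weighted.weighted m (θ m) (embed m a)

    θ-hom : ∀ m → IsRingHom (Series m) (Series m) (θ m)
    θ-hom zero    = id-hom
    θ-hom (suc m) = PS.Weighted.weighted-hom m (θ m) (embed m a) (θ-hom m)

    θ-embed : ∀ m c → S._≃_ m (θ m (embed m c)) (embed m c)
    θ-embed zero    c   = B.refl
    θ-embed (suc m) c k = S.trans m (PS.Weighted.weighted-const m (θ m) (embed m a) (θ-hom m) (embed m c) k)
                                    (IsRingHom.cong (PS.const-hom m) (θ-embed m c) k)

    θ-y : ∀ m i → S._≃_ m (θ m (y m i)) (S._*_ m (embed m a) (y m i))
    θ-y zero    i = B.sym (B.zeroʳ a)
    θ-y (suc m) i with i ℕ.≟ m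
    ... | yes _ = PS.Weighted.weighted-y m (θ m) (embed m a) (θ-hom m)
    ... | no  _ = λ k → S.trans m (PS.Weighted.weighted-const m (θ m) (embed m a) (θ-hom m) (y m i) k)
                          (S.trans m (IsRingHom.cong (PS.const-hom m) (θ-y m i) k)
                                     (IsRingHom.*-homo (PS.const-hom m) (embed m a) (y m i) k))

    -- If f = aᵉ θ(f), every coefficient c of f of total degree t satisfies c = a^{e+t} c.
    module _ (d : ℕ) (fixed⇒0 : ∀ e c → 1 ≤ e → e ≤ d → c B.≈ a ^ e B.* c → c B.≈ B.0#) where
      eigen-vanish : ∀ m e f → S._≃_ m f (S._*_ m (embed m (a ^ e)) (θ m f))
                     → (e ≡ 0 → coeff₀ m f B.≈ B.0#) → Vanish m d e f
      eigen-vanish zero zero    c _    c₀≈0 _   = c₀≈0 Eq.refl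
      eigen-vanish zero (suc e) c c≈ _    e≤d = fixed⇒0 (suc e) c (s≤s z≤n) e≤d c≈
      eigen-vanish (suc m) e f f≈ c₀≈0 k = eigen-vanish m (e ℕ.+ k) (f k) coefficient (constant k)
        where
        open S m
        open SemiringExp semiring using () renaming (_^_ to _^ₘ_)
        open SetoidReasoning setoid
        module E = IsRingHom (embed-hom m)
        coefficient : f k ≃ embed m (a ^ (e ℕ.+ k)) * θ m (f k)
        coefficient = begin
            f k                                                ≈⟨ f≈ k ⟩
            PS._*ₛ_ m (PS.const m (embed m (a ^ e))) (θ (suc m) f) k ≈⟨ PS.const-*ₛ m _ _ k ⟩
            embed m (a ^ e) * (embed m a ^ₘ k * θ m (f k))     ≈⟨ sym (*-assoc _ _ _) ⟩
            embed m (a ^ e) * embed m a ^ₘ k * θ m (f k)       ≈⟨ *-cong (*-cong refl (sym (^-homo (embed-hom m) a k))) refl ⟩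
            embed m (a ^ e) * embed m (a ^ k) * θ m (f k)      ≈⟨ *-cong (sym (E.*-homo _ _)) refl ⟩
            embed m (a ^ e B.* a ^ k) * θ m (f k)              ≈⟨ *-cong (E.cong (B.sym (^-homo-* a e k))) refl ⟩
            embed m (a ^ (e ℕ.+ k)) * θ m (f k)                ∎
          where open SemiringExp B.semiring using (^-homo-*)
        constant : ∀ k → e ℕ.+ k ≡ 0 → coeff₀ m (f k) B.≈ B.0#
        constant zero    e+0≡0 = c₀≈0 (Eq.trans (Eq.sym (ℕP.+-identityʳ e)) e+0≡0)
        constant (suc k) e+k≡0 with ℕP.m+n≡0⇒n≡0 e e+k≡0
        ... | ()

module Horner (m : ℕ) where
  open CommutativeRing polyRing
    using (zeroˡ; zeroʳ; distribʳ; +-identityʳ; *-identityʳ; ring; setoid; +-commutativeSemigroup; *-commutativeSemigroup)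
  open CommutativeSemigroupProperties +-commutativeSemigroup using (interchange)
  open CommutativeSemigroupProperties *-commutativeSemigroup using (x∙yz≈y∙xz)
  open RingProperties ring using (-‿distribʳ-*; -‿+-comm)
  open SetoidReasoning setoid

  Coeff : Set
  Coeff = Σ Poly (InVars m)

  x : Poly
  x = var m

  horner : List Coeff → Poly
  horner []             = con 0ℤ
  horner ((c , _) ∷ cs) = c ⊕ x ⊗ horner cs

  addᴴ : List Coeff → List Coeff → List Coeff
  addᴴ [] ds = ds
  addᴴ cs [] = cs
  addᴴ ((c , c∈) ∷ cs) ((d , d∈) ∷ ds) = (c ⊕ d , c∈ ⊕ d∈) ∷ addᴴ cs ds

  negᴴ : List Coeff → List Coeff
  negᴴ [] = []
  negᴴ ((c , c∈) ∷ cs) = (⊝ c , ⊝ c∈) ∷ negᴴ cs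

  scaleᴴ : Coeff → List Coeff → List Coeff
  scaleᴴ a [] = []
  scaleᴴ (a , a∈) ((c , c∈) ∷ cs) = (a ⊗ c , a∈ ⊗ c∈) ∷ scaleᴴ (a , a∈) cs

  mulᴴ : List Coeff → List Coeff → List Coeff
  mulᴴ [] ds = []
  mulᴴ (c ∷ cs) ds = addᴴ (scaleᴴ c ds) ((con 0ℤ , con 0ℤ) ∷ mulᴴ cs ds)

  addᴴ-correct : ∀ cs ds → horner (addᴴ cs ds) ≈ horner cs ⊕ horner ds
  addᴴ-correct [] ds = ≈-sym (⊕-idˡ _)
  addᴴ-correct (c ∷ cs) [] = ≈-sym (≈-trans (⊕-comm _ _) (⊕-idˡ _))
  addᴴ-correct ((c , _) ∷ cs) ((d , _) ∷ ds) = begin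
      (c ⊕ d) ⊕ x ⊗ horner (addᴴ cs ds)           ≈⟨ ⊕-cong ≈-refl (⊗-cong ≈-refl (addᴴ-correct cs ds)) ⟩
      (c ⊕ d) ⊕ x ⊗ (horner cs ⊕ horner ds)       ≈⟨ ⊕-cong ≈-refl (distribˡ _ _ _) ⟩
      (c ⊕ d) ⊕ (x ⊗ horner cs ⊕ x ⊗ horner ds)   ≈⟨ interchange _ _ _ _ ⟩
      (c ⊕ x ⊗ horner cs) ⊕ (d ⊕ x ⊗ horner ds)   ∎

  negᴴ-correct : ∀ cs → horner (negᴴ cs) ≈ ⊝ horner cs
  negᴴ-correct [] = ≈-sym (con-neg 0ℤ)
  negᴴ-correct ((c , _) ∷ cs) = begin
      ⊝ c ⊕ x ⊗ horner (negᴴ cs)   ≈⟨ ⊕-cong ≈-refl (⊗-cong ≈-refl (negᴴ-correct cs)) ⟩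
      ⊝ c ⊕ x ⊗ (⊝ horner cs)      ≈⟨ ⊕-cong ≈-refl (≈-sym (-‿distribʳ-* _ _)) ⟩
      ⊝ c ⊕ ⊝ (x ⊗ horner cs)      ≈⟨ -‿+-comm _ _ ⟩
      ⊝ (c ⊕ x ⊗ horner cs)        ∎

  scaleᴴ-correct : ∀ a cs → horner (scaleᴴ a cs) ≈ proj₁ a ⊗ horner cs
  scaleᴴ-correct (a , _) [] = ≈-sym (zeroʳ a)
  scaleᴴ-correct (a , a∈) ((c , _) ∷ cs) = begin
      a ⊗ c ⊕ x ⊗ horner (scaleᴴ (a , a∈) cs)   ≈⟨ ⊕-cong ≈-refl (⊗-cong ≈-refl (scaleᴴ-correct (a , a∈) cs)) ⟩
      a ⊗ c ⊕ x ⊗ (a ⊗ horner cs)              ≈⟨ ⊕-cong ≈-refl (x∙yz≈y∙xz _ _ _) ⟩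
      a ⊗ c ⊕ a ⊗ (x ⊗ horner cs)              ≈⟨ ≈-sym (distribˡ _ _ _) ⟩
      a ⊗ (c ⊕ x ⊗ horner cs)                  ∎

  mulᴴ-correct : ∀ cs ds → horner (mulᴴ cs ds) ≈ horner cs ⊗ horner ds
  mulᴴ-correct [] ds = ≈-sym (zeroˡ _)
  mulᴴ-correct ((c , c∈) ∷ cs) ds = begin
      horner (addᴴ (scaleᴴ (c , c∈) ds) ((con 0ℤ , con 0ℤ) ∷ mulᴴ cs ds))
    ≈⟨ addᴴ-correct (scaleᴴ (c , c∈) ds) _ ⟩
      horner (scaleᴴ (c , c∈) ds) ⊕ (con 0ℤ ⊕ x ⊗ horner (mulᴴ cs ds))
    ≈⟨ ⊕-cong (scaleᴴ-correct (c , c∈) ds) (≈-trans (⊕-idˡ _) (⊗-cong ≈-refl (mulᴴ-correct cs ds))) ⟩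
      c ⊗ horner ds ⊕ x ⊗ (horner cs ⊗ horner ds)
    ≈⟨ ⊕-cong ≈-refl (≈-sym (⊗-assoc _ _ _)) ⟩
      c ⊗ horner ds ⊕ (x ⊗ horner cs) ⊗ horner ds
    ≈⟨ ≈-sym (distribʳ _ _ _) ⟩
      (c ⊕ x ⊗ horner cs) ⊗ horner ds ∎

  varᴴ : ∀ {i} → i < suc m → List Coeff
  varᴴ {i} i<1+m with i ℕ.≟ m
  ... | yes _   = (con 0ℤ , con 0ℤ) ∷ (con 1ℤ , con 1ℤ) ∷ []
  ... | no  i≢m = (var i , var (ℕP.≤∧≢⇒< (ℕP.≤-pred i<1+m) i≢m)) ∷ []

  varᴴ-correct : ∀ {i} (i<1+m : i < suc m) → var i ≈ horner (varᴴ i<1+m)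
  varᴴ-correct {i} i<1+m with i ℕ.≟ m
  ... | yes Eq.refl = ≈-sym (begin
      con 0ℤ ⊕ x ⊗ (con 1ℤ ⊕ x ⊗ con 0ℤ)   ≈⟨ ⊕-idˡ _ ⟩
      x ⊗ (con 1ℤ ⊕ x ⊗ con 0ℤ)            ≈⟨ ⊗-cong ≈-refl (≈-trans (⊕-cong ≈-refl (zeroʳ x)) (+-identityʳ _)) ⟩
      x ⊗ con 1ℤ                           ≈⟨ *-identityʳ x ⟩
      x                                    ∎)
  ... | no  _ = ≈-sym (≈-trans (⊕-cong ≈-refl (zeroʳ _)) (+-identityʳ _))

  coefficients : ∀ {q} → InVars (suc m) q → List Coeff
  coefficients (con a)           = (con a , con a) ∷ []
  coefficients (var i<1+m)       = varᴴ i<1+m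
  coefficients (q∈ ⊕ r∈) = addᴴ (coefficients q∈) (coefficients r∈)
  coefficients (q∈ ⊗ r∈) = mulᴴ (coefficients q∈) (coefficients r∈)
  coefficients (⊝ q∈)    = negᴴ (coefficients q∈)

  horner-coefficients : ∀ {q} (q∈ : InVars (suc m) q) → q ≈ horner (coefficients q∈)
  horner-coefficients (con a)     = ≈-sym (≈-trans (⊕-cong ≈-refl (zeroʳ _)) (+-identityʳ _))
  horner-coefficients (var i<1+m) = varᴴ-correct i<1+m
  horner-coefficients (q∈ ⊕ r∈) =
    ≈-trans (⊕-cong (horner-coefficients q∈) (horner-coefficients r∈)) (≈-sym (addᴴ-correct _ _))
  horner-coefficients (q∈ ⊗ r∈) =
    ≈-trans (⊗-cong (horner-coefficients q∈) (horner-coefficients r∈)) (≈-sym (mulᴴ-correct _ _))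
  horner-coefficients (⊝ q∈) =
    ≈-trans (⊝-cong (horner-coefficients q∈)) (≈-sym (negᴴ-correct _))

module TowerEvaluation {B : CommutativeRing 0ℓ 0ℓ} {ι} (ι-hom : IsRingHom ℤ-ring B ι) where
  open Tower B
  private module B = CommutativeRing B

  ιₘ : ∀ m → ℤ → S m
  ιₘ m = embed m ∘ ι

  ιₘ-hom : ∀ m → IsRingHom ℤ-ring (Series m) (ιₘ m)
  ιₘ-hom m = ∘-hom (embed-hom m) ι-hom

  E : ∀ m → Poly → S m
  E m = eval (Series m) (ιₘ m) (y m)

  E-cong : ∀ m {p q} → p ≈ q → S._≃_ m (E m p) (E m q)
  E-cong m = eval-cong (Series m) (ιₘ-hom m) (y m)

  coeff₀-eval : ∀ m v → (∀ i → coeff₀ m (v i) B.≈ B.0#) → ∀ p →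
                coeff₀ m (eval (Series m) (ιₘ m) v p) B.≈ ι (constTerm p)
  coeff₀-eval m v v₀≈0 p = begin
      coeff₀ m (eval (Series m) (ιₘ m) v p)          ≈⟨ eval-hom (coeff₀-hom m) (ιₘ m) v p ⟩
      eval B (coeff₀ m ∘ ιₘ m) (coeff₀ m ∘ v) p      ≈⟨ eval-ext B (λ a → B.reflexive (coeff₀-embed m (ι a))) v₀≈0 p ⟩
      eval B ι (λ _ → B.0#) p                        ≈⟨ eval-at-zero B ι-hom p ⟩
      ι (constTerm p)                                ∎
    where open SetoidReasoning B.setoid

  E-lift : ∀ m {q} → InVars m q → S._≃_ (suc m) (E (suc m) q) (PS.const m (E m q))
  E-lift m {q} q∈ = S.trans (suc m)
    (eval-local (Series (suc m)) (ιₘ (suc m)) q∈ (λ i i<m → S.reflexive (suc m) (y-below m i<m)))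
    (S.sym (suc m) (eval-hom (PS.const-hom m) (ιₘ m) (y m) q))

  split-vanish : ∀ m {d e c} (c∈ : InVars m c) cs →
                 Vanish (suc m) d e (E (suc m) (Horner.horner m ((c , c∈) ∷ cs))) →
                 Vanish m d e (E m c) × Vanish (suc m) d (suc e) (E (suc m) (Horner.horner m cs))
  split-vanish m {d} {e} {c} c∈ cs vanishes =
    Vanish-cong m (+-identityʳ _) (Eq.subst (λ t → Vanish m d t (E m c + 0#)) (ℕP.+-identityʳ e) (vanishes′ 0)) ,
    λ k → Vanish-cong m (+-identityˡ _) (Eq.subst (λ t → Vanish m d t (0# + r k)) (ℕP.+-suc e k) (vanishes′ (suc k)))
    where
    open S m
    r = E (suc m) (Horner.horner m cs)
    split : S._≃_ (suc m) (E (suc m) (Horner.horner m ((c , c∈) ∷ cs))) (PS._+ₛ_ m (PS.const m (E m c)) (PS.shift m r))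
    split k = +-cong (E-lift m c∈ k)
                     (trans (PS.*ₛ-cong m (S.reflexive (suc m) (y-top m)) (λ _ → refl) k) (PS.y-*ₛ m r k))
    vanishes′ : Vanish (suc m) d e (PS._+ₛ_ m (PS.const m (E m c)) (PS.shift m r))
    vanishes′ = Vanish-cong (suc m) split vanishes

module Faithful (B : ℕ → CommutativeRing 0ℓ 0ℓ)
                {ι : ∀ d → ℤ → CommutativeRing.Carrier (B d)}
                (ι-hom : ∀ d → IsRingHom ℤ-ring (B d) (ι d))
                (separating : ∀ e c → (∀ d → e ≤ d → CommutativeRing._≈_ (B d) (ι d c) (CommutativeRing.0# (B d)))
                                    → c ≡ 0ℤ)
                where
  module T d = Tower (B d)
  module TE d = TowerEvaluation (ι-hom d)

  -- Induction on m: for m = 0, q is its constant term, and E d 0 q is q evaluated at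
  -- the origin; for m + 1, argue coefficientwise on the Horner form in x_{m+1}.
  mutual
    faithful : ∀ m e {q} → InVars m q → (∀ d → T.Vanish d m d e (TE.E d m q)) → q ≈ con 0ℤ
    faithful zero e {q} q∈ vanishes = ≈-trans (constant-poly q∈)
      (Eq.subst (λ c → con (constTerm q) ≈ con c) (separating e (constTerm q) const-vanishes) ≈-refl)
      where
      const-vanishes : ∀ d → e ≤ d → CommutativeRing._≈_ (B d) (ι d (constTerm q)) (CommutativeRing.0# (B d))
      const-vanishes d e≤d = CommutativeRing.trans (B d)
        (CommutativeRing.sym (B d) (eval-at-zero (B d) (ι-hom d) q)) (vanishes d e≤d)
    faithful (suc m) e q∈ vanishes = ≈-trans (Horner.horner-coefficients m q∈)
      (faithfulᴴ m e (Horner.coefficients m q∈)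
        (λ d → T.Vanish-cong d (suc m) (TE.E-cong d (suc m) (Horner.horner-coefficients m q∈)) (vanishes d)))

    faithfulᴴ : ∀ m e cs → (∀ d → T.Vanish d (suc m) d e (TE.E d (suc m) (Horner.horner m cs))) →
                Horner.horner m cs ≈ con 0ℤ
    faithfulᴴ m e [] _ = ≈-refl
    faithfulᴴ m e ((c , c∈) ∷ cs) vanishes = ≈-trans
      (⊕-cong (faithful m e c∈ (λ d → proj₁ (TE.split-vanish d m c∈ cs (vanishes d))))
              (⊗-cong ≈-refl (faithfulᴴ m (suc e) cs (λ d → proj₂ (TE.split-vanish d m c∈ cs (vanishes d))))))
      (≈-trans (⊕-idˡ _) (CommutativeRing.zeroʳ polyRing _))

-- The d-th modulus N d = 2^{r d} − 1 with period r d = d! + 1: modulo N d we have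
-- 2^{r d} = 1, while for 1 ≤ e ≤ d the equation c = 2ᵉc forces c = 0.
period : ℕ → ℕ
period d = suc (d !)

modulus : ℕ → ℤ
modulus d = + (2 ℕ.^ period d ∸ 1)

n≤n! : ∀ n → n ≤ n !
n≤n! zero    = z≤n
n≤n! (suc n) = ℕP.m≤m*n (suc n) (n !) {{n ℕP.!≢0}}

n<2^n : ∀ n → n < 2 ℕ.^ n
n<2^n zero    = s≤s z≤n
n<2^n (suc n) = ℕP.+-mono-≤-< (ℕP.m^n>0 2 n) (ℕP.<-≤-trans (n<2^n n) (ℕP.m≤m+n _ 0))

d<modulus : ∀ d → d < ∣ modulus d ∣
d<modulus d = ℕP.≤-<-trans (n≤n! d) (ℕP.<-≤-trans (n<2^n (d !)) (begin
    x                      ≤⟨ ℕP.m≤m+n x _ ⟩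
    x ℕ.+ (x ℕ.+ 0 ∸ 1)    ≡⟨ ℕP.+-∸-assoc x (ℕP.≤-trans (ℕP.m^n>0 2 (d !)) (ℕP.m≤m+n x 0)) ⟨
    x ℕ.+ (x ℕ.+ 0) ∸ 1    ∎))
  where
  open ℕP.≤-Reasoning
  x = 2 ℕ.^ (d !)

module Modulus (d : ℕ) where
  open ZMod (modulus d) public
  open CommutativeRing ring using (_+_; _*_; 0#; 1#; setoid; *-assoc; *-cong; +-cong; *-identityˡ; distribʳ; refl; sym; trans)
  open RingProperties (CommutativeRing.ring ring) using (x+x≈x⇒x≈0)
  open SemiringExp (CommutativeRing.semiring ring) using (_^_; ^-homo-*; ^-congʳ)

  2^k≡2ℕ^k : ∀ k → (+ 2) ^ k ≡ + (2 ℕ.^ k)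
  2^k≡2ℕ^k zero    = Eq.refl
  2^k≡2ℕ^k (suc k) = Eq.trans (Eq.cong (+ 2 ℤ.*_) (2^k≡2ℕ^k k)) (Eq.sym (ℤP.pos-* 2 (2 ℕ.^ k)))

  2^period≈1 : (+ 2) ^ period d ≡ₙ 1#
  2^period≈1 = mod (divides 1ℤ (begin
      (+ 2) ^ period d ℤ.- 1ℤ          ≡⟨ Eq.cong (ℤ._- 1ℤ) (2^k≡2ℕ^k (period d)) ⟩
      + (2 ℕ.^ period d) ℤ.- 1ℤ        ≡⟨ ℤP.m-n≡m⊖n (2 ℕ.^ period d) 1 ⟩
      2 ℕ.^ period d ℤ.⊖ 1             ≡⟨ ℤP.⊖-≥ (ℕP.m^n>0 2 (period d)) ⟩
      modulus d                        ≡⟨ ℤP.*-identityˡ (modulus d) ⟨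
      1ℤ ℤ.* modulus d                 ∎))
    where open Eq.≡-Reasoning

  -- Modulo N d, c = 2ᵉc with 1 ≤ e ≤ d forces c = 0: iterating gives c = 2^{d!}c,
  -- hence 2c = 2^{r d}c = c.
  fixed⇒0 : ∀ e c → 1 ≤ e → e ≤ d → c ≡ₙ (+ 2) ^ e * c → c ≡ₙ 0#
  fixed⇒0 (suc e′) c _ e≤d c≈2ᵉc = x+x≈x⇒x≈0 c (begin
      c + c                                    ≈⟨ +-cong (*-identityˡ c) (*-identityˡ c) ⟨
      1# * c + 1# * c                          ≈⟨ distribʳ c 1# 1# ⟨
      (+ 2) * c                                ≈⟨ *-cong (refl {+ 2}) c≈2^d!c ⟩
      (+ 2) * ((+ 2) ^ (d !) * c)              ≈⟨ *-assoc (+ 2) ((+ 2) ^ (d !)) c ⟨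
      (+ 2) ^ period d * c                     ≈⟨ *-cong 2^period≈1 (refl {c}) ⟩
      1# * c                                   ≈⟨ *-identityˡ c ⟩
      c                                        ∎)
    where
    open SetoidReasoning setoid
    e = suc e′
    iterate : ∀ t → c ≡ₙ (+ 2) ^ (e ℕ.* t) * c
    iterate zero    = trans (sym (*-identityˡ c)) (*-cong (^-congʳ (+ 2) (Eq.sym (ℕP.*-zeroʳ e))) (refl {c}))
    iterate (suc t) = begin
        c                                      ≈⟨ c≈2ᵉc ⟩
        (+ 2) ^ e * c                          ≈⟨ *-cong (refl {(+ 2) ^ e}) (iterate t) ⟩
        (+ 2) ^ e * ((+ 2) ^ (e ℕ.* t) * c)    ≈⟨ *-assoc ((+ 2) ^ e) ((+ 2) ^ (e ℕ.* t)) c ⟨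
        (+ 2) ^ e * (+ 2) ^ (e ℕ.* t) * c      ≈⟨ *-cong (^-homo-* (+ 2) e (e ℕ.* t)) (refl {c}) ⟨
        (+ 2) ^ (e ℕ.+ e ℕ.* t) * c            ≈⟨ *-cong (^-congʳ (+ 2) (ℕP.*-suc e t)) (refl {c}) ⟨
        (+ 2) ^ (e ℕ.* suc t) * c              ∎
    e∣d! : e ℕ∣.∣ d !
    e∣d! = ℕ∣.∣-trans (ℕ∣.m∣m*n (e′ !)) (ℕ∣.m≤n⇒m!∣n! e≤d)
    c≈2^d!c : c ≡ₙ (+ 2) ^ (d !) * c
    c≈2^d!c = trans (iterate (ℕ∣.quotient e∣d!))
      (*-cong (^-congʳ (+ 2) (Eq.sym (Eq.trans (ℕ∣._∣_.equality e∣d!) (ℕP.*-comm (ℕ∣.quotient e∣d!) e)))) (refl {c}))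

-- An integer divisible by N d for every d ≥ e is zero, because N d > d.
eventually-divisible⇒0 : ∀ e c → (∀ d → e ≤ d → ZMod._≡ₙ_ (modulus d) c 0ℤ) → c ≡ 0ℤ
eventually-divisible⇒0 e c multiple = ℤP.∣i∣≡0⇒i≡0 (small-multiple |c|<N (∣⇒∣ᵤ N∣c))
  where
  D = e ℕ.+ ∣ c ∣
  N∣c : modulus D ∣ c
  N∣c = Eq.subst (modulus D ∣_) (ℤP.+-identityʳ c) (ZMod.divisible (multiple D (ℕP.m≤m+n e ∣ c ∣)))
  |c|<N : ∣ c ∣ < ∣ modulus D ∣
  |c|<N = ℕP.≤-<-trans (ℕP.m≤n+m ∣ c ∣ e) (d<modulus D)
  small-multiple : ∀ {k N} → k < N → N ℕ∣.∣ k → k ≡ 0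
  small-multiple {zero}  _   _   = Eq.refl
  small-multiple {suc k} k<N N∣k = ⊥-elim (ℕ∣.>⇒∤ k<N N∣k)

module CyclicShift (L : ℕ) .{{_ : NonZero L}} where
  rotate : ℕ → ℕ → ℕ
  rotate k l with l <? L
  ... | yes _ = (l ℕ.+ k) % L
  ... | no  _ = l

  rotate-< : ∀ {n} k l → L ≤ n → l < n → rotate k l < n
  rotate-< k l L≤n l<n with l <? L
  ... | yes _ = ℕP.<-≤-trans (m%n<n (l ℕ.+ k) L) L≤n
  ... | no  _ = l<n

  rotate-inverse : ∀ a b → a ℕ.+ b ≡ L → ∀ l → rotate b (rotate a l) ≡ l
  rotate-inverse a b a+b≡L l with l <? L
  rotate-inverse a b a+b≡L l | no l≮L with l <? L
  ... | yes l<L = ⊥-elim (l≮L l<L)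
  ... | no  _   = Eq.refl
  rotate-inverse a b a+b≡L l | yes l<L with (l ℕ.+ a) % L <? L
  ... | no ≮L = ⊥-elim (≮L (m%n<n _ L))
  ... | yes _ = begin
      ((l ℕ.+ a) % L ℕ.+ b) % L                   ≡⟨ %-distribˡ-+ ((l ℕ.+ a) % L) b L ⟩
      ((l ℕ.+ a) % L % L ℕ.+ b % L) % L           ≡⟨ Eq.cong (λ t → (t ℕ.+ b % L) % L) (m%n%n≡m%n (l ℕ.+ a) L) ⟩
      ((l ℕ.+ a) % L ℕ.+ b % L) % L               ≡⟨ %-distribˡ-+ (l ℕ.+ a) b L ⟨
      (l ℕ.+ a ℕ.+ b) % L                         ≡⟨ Eq.cong (_% L) (Eq.trans (ℕP.+-assoc l a b) (Eq.cong (l ℕ.+_) a+b≡L)) ⟩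
      (l ℕ.+ L) % L                               ≡⟨ [m+n]%n≡m%n l L ⟩
      l % L                                       ≡⟨ m<n⇒m%n≡m l<L ⟩
      l                                           ∎
    where open Eq.≡-Reasoning

  rotate-inside : ∀ k {l} → l < L → rotate k l ≡ (l ℕ.+ k) % L
  rotate-inside k {l} l<L with l <? L
  ... | yes _   = Eq.refl
  ... | no  l≮L = ⊥-elim (l≮L l<L)

  rotate-outside : ∀ k l → ¬ (l < L) → rotate k l ≡ l
  rotate-outside k l l≮L with l <? L
  ... | yes l<L = ⊥-elim (l≮L l<L)
  ... | no  _   = Eq.refl

  module _ {n m : ℕ} (L≤n : L ≤ n) (m≤L : m ≤ L) where
    σ : Permutation′ n
    σ = permutation (onFin m) (onFin (L ∸ m))
          (λ i → toℕ-injective (inverse (L ∸ m) m (Eq.trans (ℕP.+-comm (L ∸ m) m) (ℕP.m+[n∸m]≡n m≤L)) i))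
          (λ i → toℕ-injective (inverse m (L ∸ m) (ℕP.m+[n∸m]≡n m≤L) i))
      where
      onFin : ℕ → Fin n → Fin n
      onFin k i = fromℕ< (rotate-< k (toℕ i) L≤n (toℕ<n i))
      inverse : ∀ a b → a ℕ.+ b ≡ L → ∀ i → toℕ (onFin b (onFin a i)) ≡ toℕ i
      inverse a b a+b≡L i = Eq.trans (toℕ-fromℕ< _)
        (Eq.trans (Eq.cong (rotate b) (toℕ-fromℕ< _)) (rotate-inverse a b a+b≡L (toℕ i)))

    permVar-σ : ∀ l → permVar σ l ≡ rotate m l
    permVar-σ l with l <? n
    ... | yes l<n = Eq.trans (toℕ-fromℕ< _) (Eq.cong (rotate m) (toℕ-fromℕ< l<n))
    ... | no  l≮n = Eq.sym (rotate-outside m l (λ l<L → l≮n (ℕP.<-≤-trans l<L L≤n)))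

-- The core construction, for the modulus N d, m ≥ 1 and n ≥ L = r d · m: substitute
-- x_{l+1} ↦ 2^{⌊l/m⌋} y_{l mod m} for l < L and x_{l+1} ↦ 0 beyond.  The cyclic shift
-- l ↦ l + m (mod L) of the variables then acts on values as θ (the degree-t part is
-- multiplied by 2ᵗ), since 2^{r d} = 1; so images of symmetric polynomials are
-- θ-fixed and vanish to order d, and hence so does the image of IΛₙ.
module Substitution (d m : ℕ) .{{_ : NonZero m}} {n : ℕ} (L≤n : period d ℕ.* m ≤ n) where
  open Modulus d using (ring; reduce-hom; 2^period≈1; fixed⇒0; _≡ₙ_)
  private module B = CommutativeRing ring
  open Tower ring
  open Weight (+ 2)
  open TowerEvaluation reduce-hom
  open S m
  open SemiringExp semiring using (_^_; ^-congˡ)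
  open CommutativeSemigroupProperties *-commutativeSemigroup using (xy∙z≈y∙xz)
  open SetoidReasoning setoid

  L : ℕ
  L = period d ℕ.* m

  instance
    L≢0 : NonZero L
    L≢0 = ℕP.m*n≢0 (period d) m

  open CyclicShift L

  m≤L : m ≤ L
  m≤L = ℕP.m≤n*m m (period d)

  two : S m
  two = embed m (+ 2)

  v : ℕ → S m
  v l with l <? L
  ... | yes _ = two ^ (l / m) * y m (l % m)
  ... | no  _ = 0#

  v-inside : ∀ {l} → l < L → v l ≡ two ^ (l / m) * y m (l % m)
  v-inside {l} l<L with l <? L
  ... | yes _   = Eq.refl
  ... | no  l≮L = ⊥-elim (l≮L l<L)

  v-outside : ∀ {l} → ¬ l < L → v l ≡ 0#
  v-outside {l} l≮L with l <? L
  ... | yes l<L = ⊥-elim (l≮L l<L)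
  ... | no  _   = Eq.refl

  F : Poly → S m
  F = eval (Series m) (ιₘ m) v

  v-below : ∀ i → i < m → v i ≃ y m i
  v-below i i<m = begin
      v i                             ≡⟨ v-inside (ℕP.<-≤-trans i<m m≤L) ⟩
      two ^ (i / m) * y m (i % m)     ≡⟨ Eq.cong₂ (λ j k → two ^ j * y m k) (m<n⇒m/n≡0 i<m) (m<n⇒m%n≡m i<m) ⟩
      1# * y m i                      ≈⟨ *-identityˡ _ ⟩
      y m i                           ∎

  coeff₀-v : ∀ l → coeff₀ m (v l) ≡ₙ 0ℤ
  coeff₀-v l with l <? L
  ... | no  _ = IsRingHom.0#-homo (coeff₀-hom m)
  ... | yes _ = B.trans (IsRingHom.*-homo (coeff₀-hom m) _ _)
                  (B.trans (B.*-cong (B.refl {c}) (coeff₀-y m (l % m))) (B.zeroʳ c))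
    where c = coeff₀ m (two ^ (l / m))

  v-rotate : ∀ l → v (rotate m l) ≃ θ m (v l)
  v-rotate l = by-cases (l <? L)
    where
    θ-fixes-powers : θ m (two ^ (l / m)) ≃ two ^ (l / m)
    θ-fixes-powers = trans (^-homo (θ-hom m) two (l / m)) (^-congˡ (l / m) (θ-embed m (+ 2)))
    quotient : (l ℕ.+ m) % L / m ≡ suc (l / m) % period d
    quotient = Eq.trans (m%[n*o]/o≡m/o%n (l ℕ.+ m) (period d) m)
      (Eq.cong (_% period d) (Eq.trans (m/n≡1+[m∸n]/n (ℕP.m≤n+m m l)) (Eq.cong (λ t → suc (t / m)) (ℕP.m+n∸n≡m l m))))
    remainder : (l ℕ.+ m) % L % m ≡ l % m
    remainder = Eq.trans (m∣n⇒o%n%m≡o%m m L (l ℕ.+ m) (ℕ∣.divides (period d) Eq.refl)) ([m+n]%n≡m%n l m)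
    two^period≈1 : two ^ period d ≃ 1#
    two^period≈1 = trans (sym (^-homo (embed-hom m) (+ 2) (period d)))
                         (trans (IsRingHom.cong (embed-hom m) 2^period≈1) (IsRingHom.1#-homo (embed-hom m)))
    by-cases : Dec (l < L) → v (rotate m l) ≃ θ m (v l)
    by-cases (no l≮L) = begin
      v (rotate m l)     ≡⟨ Eq.cong v (rotate-outside m l l≮L) ⟩
      v l                ≡⟨ v-outside l≮L ⟩
      0#                 ≈⟨ IsRingHom.0#-homo (θ-hom m) ⟨
      θ m 0#             ≡⟨ Eq.cong (θ m) (v-outside l≮L) ⟨
      θ m (v l)          ∎
    by-cases (yes l<L) = begin
      v (rotate m l)                                   ≡⟨ Eq.cong v (rotate-inside m l<L) ⟩
      v ((l ℕ.+ m) % L)                                ≡⟨ v-inside (m%n<n (l ℕ.+ m) L) ⟩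
      two ^ ((l ℕ.+ m) % L / m) * y m ((l ℕ.+ m) % L % m)
                                                       ≡⟨ Eq.cong₂ (λ j k → two ^ j * y m k) quotient remainder ⟩
      two ^ (suc (l / m) % period d) * y m (l % m)     ≈⟨ *-cong (^-mod (Series m) two (period d) two^period≈1 (suc (l / m))) refl ⟩
      two * two ^ (l / m) * y m (l % m)                ≈⟨ xy∙z≈y∙xz _ _ _ ⟩
      two ^ (l / m) * (two * y m (l % m))              ≈⟨ *-cong θ-fixes-powers (θ-y m (l % m)) ⟨
      θ m (two ^ (l / m)) * θ m (y m (l % m))          ≈⟨ IsRingHom.*-homo (θ-hom m) _ _ ⟨
      θ m (two ^ (l / m) * y m (l % m))                ≡⟨ Eq.cong (θ m) (v-inside l<L) ⟨
      θ m (v l)                                        ∎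

  symmetric-vanishes : ∀ {s} → SymGen n s → Vanish m d 0 (F s)
  symmetric-vanishes {s} (_ , invariant , constTerm≡0) =
    eigen-vanish d fixed⇒0 m 0 (F s) F≈θF (λ _ → coeff₀-F)
    where
    σ′ = σ L≤n m≤L
    shifted : ∀ l → θ m (v l) ≃ v (permVar σ′ l)
    shifted l = trans (sym (v-rotate l)) (reflexive (Eq.cong v (Eq.sym (permVar-σ L≤n m≤L l))))
    θF≈F : θ m (F s) ≃ F s
    θF≈F = begin
        θ m (F s)                                      ≈⟨ eval-hom (θ-hom m) (ιₘ m) v s ⟩
        eval (Series m) (θ m ∘ ιₘ m) (θ m ∘ v) s       ≈⟨ eval-ext (Series m) (λ a → θ-embed m a) shifted s ⟩
        eval (Series m) (ιₘ m) (v ∘ permVar σ′) s      ≡⟨ eval-rename (Series m) (ιₘ m) v σ′ s ⟨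
        F (rename σ′ s)                                ≈⟨ eval-cong (Series m) (ιₘ-hom m) v (invariant σ′) ⟩
        F s                                            ∎
    F≈θF : F s ≃ embed m B.1# * θ m (F s)
    F≈θF = sym (trans (*-cong (IsRingHom.1#-homo (embed-hom m)) θF≈F) (*-identityˡ (F s)))
    coeff₀-F : coeff₀ m (F s) ≡ₙ 0ℤ
    coeff₀-F = B.trans (coeff₀-eval m v coeff₀-v s) (B.reflexive constTerm≡0)

  ideal-vanishes : ∀ {xs} → AllGen n xs → Vanish m d 0 (F (sumProd xs))
  ideal-vanishes []                     = Vanish-cong m (sym (IsRingHom.0#-homo (ιₘ-hom m))) (Vanish-0 m)
  ideal-vanishes ((_ , symmetric) ∷ gs) =
    Vanish-+ m (Vanish-* m _ (symmetric-vanishes symmetric)) (ideal-vanishes gs)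

  IΛ-vanishes : ∀ {p q} → InVars m q → p ≈ q → IΛ n p → Vanish m d 0 (E m q)
  IΛ-vanishes {p} {q} q∈ p≈q (xs , gens , p≈Σ) = Vanish-cong m F-Σ≈E-q (ideal-vanishes gens)
    where
    F-Σ≈E-q : F (sumProd xs) ≃ E m q
    F-Σ≈E-q = begin
        F (sumProd xs)   ≈⟨ eval-cong (Series m) (ιₘ-hom m) v (≈-trans (≈-sym p≈Σ) p≈q) ⟩
        F q              ≈⟨ eval-local (Series m) (ιₘ m) q∈ v-below ⟩
        E m q            ∎

lemma3p3 : (ns : ℕ → ℕ) → (∀ i → 1 ≤ ns i)
    → (∀ M → ∃ λ N → ∀ i → N ≤ i → M ≤ ns i)
    → ∀ (p : Poly) → (∀ i → IΛ (ns i) p) → p ≈ con 0ℤ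
-- With m = n₀ ≥ 1, p equals some q ∈ ℤ[x₁,…,xₘ]; q vanishes to every order d, so q = 0.
lemma3p3 ns ns≥1 ns→∞ p p∈IΛ with ns 0 | ns≥1 0 | IΛ⊆ℤ[x] (p∈IΛ 0)
... | suc m′ | _ | q , q∈ , p≈q = ≈-trans p≈q (faithful (suc m′) 0 q∈ vanishes)
  where
  open Faithful Modulus.ring Modulus.reduce-hom eventually-divisible⇒0
  -- For each d choose nᵢ ≥ r d · m; the image of p ∈ IΛ_{nᵢ} vanishes to order d.
  vanishes : ∀ d → T.Vanish d (suc m′) d 0 (TE.E d (suc m′) q)
  vanishes d with ns→∞ (period d ℕ.* suc m′)
  ... | i , large = Substitution.IΛ-vanishes d (suc m′) (large i ℕP.≤-refl) q∈ p≈q (p∈IΛ i)
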